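{- If a positive integer $B$ is both a Ball magic number and a reverse divisor, then $B+B'=10B$, where $B'$ is the reverse of $B$.
   Context: Ball magic number: let $N\ge 2$ and let $x$ be a positive integer with exactly $N$ decimal digits, $x=a_{N-1}\dots a_0$ with $a_{N-1}\neq 0$, which is not a palindrome. Its reverse $x'$ is the integer with digit string $a_0a_1\dots a_{N-1}$ (leading zeros allowed). Let $y=|x-x'|$, written as an $N$-digit string $b_{N-1}\dots b_0$ (leading zeros allowed), and let $y'$ be the integer with digit string $b_0\dots b_{N-1}$. The nonzero integer $B=y+y'$ is a Ball magic number; a Ball magic number is any integer obtained this way from some such $x$. Reverse divisor: a non-palindromic positive integer $x$ with $n\ge 2$ decimal digits is a reverse divisor if its reverse $x'$ (the integer whose decimal digits are those of $x$ in reverse order) satisfies $x'=k\cdot x$ for some integer $k$ with $1<k<10$. -}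

module Defs where

open import Data.Nat using (ℕ; zero; suc; _+_; _*_; _∸_; _^_; _≤_; _<_; _/_; _%_)
open import Data.List using (List; []; _∷_; reverse)
open import Data.Product using (Σ; ∃; _×_; _,_)
open import Relation.Binary.PropositionalEquality using (_≡_)
open import Relation.Nullary using (¬_)

-- digitsN N x : the N-digit decimal string of x (leading zeros allowed),
-- listed least significant digit first: a₀ ∷ a₁ ∷ … ∷ a_{N-1}.
digitsN : ℕ → ℕ → List ℕ
digitsN zero    x = []
digitsN (suc N) x = (x % 10) ∷ digitsN N (x / 10)

fromDigits : List ℕ → ℕ
fromDigits []       = 0
fromDigits (d ∷ ds) = d + 10 * fromDigits ds

revN : ℕ → ℕ → ℕ
revN N x = fromDigits (reverse (digitsN N x))

HasDigits : ℕ → ℕ → Set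
HasDigits N x = 10 ^ (N ∸ 1) ≤ x × x < 10 ^ N

∣_-_∣ : ℕ → ℕ → ℕ
∣ a - b ∣ = (a ∸ b) + (b ∸ a)

BallMagic : ℕ → Set
BallMagic B = Σ ℕ λ N → Σ ℕ λ x →
  2 ≤ N × HasDigits N x × ¬ (revN N x ≡ x) ×
  (let y = ∣ x - revN N x ∣ in B ≡ y + revN N y)

ReverseDivisor : ℕ → Set
ReverseDivisor x = Σ ℕ λ n → Σ ℕ λ k →
  2 ≤ n × HasDigits n x × ¬ (revN n x ≡ x) ×
  1 < k × k < 10 × revN n x ≡ k * x

Reverse : ℕ → ℕ → Set
Reverse B B' = Σ ℕ λ n → HasDigits n B × B' ≡ revN n B

-- Let B have m+1 digits, leading digit a and units digit e, with B' = k·B for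
-- some 2 ≤ k ≤ 9. Comparing units digits gives a ≡ k·e (mod 10), and comparing
-- the leading digits of k·B and B' gives k·a ≤ e < k·(a+1). A finite search
-- leaves only k = 9, when B + B' = 10B, or a = 2 and e = 8. In the latter case
-- B cannot be a Ball magic number: if B = y + y' with y of N = M+1 digits, the
-- units digit of B is that of d + c, where d and c are the units and leading
-- digits of y, so d + c ≥ 8 and 8·10^M ≤ B < 2·10^(M+1), an interval
-- containing no number whose leading digit is 2.
module Submission where

open import Data.Empty using (⊥; ⊥-elim)
open import Data.List using ([]; _∷_; _++_; [_]; length; reverse)
open import Data.List.Properties using (length-reverse; reverse-++; unfold-reverse)
open import Data.Nat hiding (∣_-_∣)
open import Data.Nat.DivMod
open import Data.Nat.Properties
open import Data.Nat.Tactic.RingSolver using (solve-∀)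
open import Data.Product using (_×_; _,_; proj₁; proj₂; map₁)
open import Data.Sum using (_⊎_; inj₁; inj₂; map₂)
open import Function using (_∘′_)
open import Relation.Binary.PropositionalEquality hiding ([_])
open import Relation.Nullary.Decidable using (Dec; _→-dec_; _⊎-dec_; _×-dec_; from-yes)

open import Defs

m<[1+m/n]*n : ∀ m n .{{_ : NonZero n}} → m < suc (m / n) * n
m<[1+m/n]*n m n = begin-strict
  m                  ≡⟨ m≡m%n+[m/n]*n m n ⟩
  m % n + m / n * n  <⟨ +-monoˡ-< (m / n * n) (m%n<n m n) ⟩
  suc (m / n) * n    ∎
  where open ≤-Reasoning

-- Division by 10 ^ n, computed as n divisions by 10: instance search cannot
-- supply NonZero (10 ^ n) for a variable n.
_/10^_ : ℕ → ℕ → ℕ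
x /10^ zero  = x
x /10^ suc n = (x / 10) /10^ n

[m/10^n]*10^n≤m : ∀ n m → m /10^ n * 10 ^ n ≤ m
[m/10^n]*10^n≤m zero    m = ≤-reflexive (*-identityʳ m)
[m/10^n]*10^n≤m (suc n) m = begin
  q * (10 * 10 ^ n)  ≡⟨ *-comm-10 q (10 ^ n) ⟩
  q * 10 ^ n * 10    ≤⟨ *-monoˡ-≤ 10 ([m/10^n]*10^n≤m n (m / 10)) ⟩
  m / 10 * 10        ≤⟨ m/n*n≤m m 10 ⟩
  m                  ∎
  where
  open ≤-Reasoning
  q = (m / 10) /10^ n
  *-comm-10 : ∀ a b → a * (10 * b) ≡ a * b * 10
  *-comm-10 = solve-∀

m<[1+m/10^n]*10^n : ∀ n m → m < suc (m /10^ n) * 10 ^ n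
m<[1+m/10^n]*10^n zero    m = s≤s (≤-reflexive (sym (*-identityʳ m)))
m<[1+m/10^n]*10^n (suc n) m = begin-strict
  m                        <⟨ m<[1+m/n]*n m 10 ⟩
  suc (m / 10) * 10        ≤⟨ *-monoˡ-≤ 10 (m<[1+m/10^n]*10^n n (m / 10)) ⟩
  suc q * 10 ^ n * 10      ≡⟨ *-comm-10 (suc q) (10 ^ n) ⟩
  suc q * (10 * 10 ^ n)    ∎
  where
  open ≤-Reasoning
  q = (m / 10) /10^ n
  *-comm-10 : ∀ a b → a * b * 10 ≡ a * (10 * b)
  *-comm-10 = solve-∀

10^n≤m⇒0<m/10^n : ∀ n m → 10 ^ n ≤ m → 0 < m /10^ n
10^n≤m⇒0<m/10^n n m 10^n≤m = ≤-pred (*-cancelʳ-< (10 ^ n) 1 _ (begin-strict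
  1 * 10 ^ n              ≡⟨ *-identityˡ (10 ^ n) ⟩
  10 ^ n                  ≤⟨ 10^n≤m ⟩
  m                       <⟨ m<[1+m/10^n]*10^n n m ⟩
  suc (m /10^ n) * 10 ^ n ∎))
  where open ≤-Reasoning

m<10^[1+n]⇒m/10^n<10 : ∀ n m → m < 10 ^ suc n → m /10^ n < 10
m<10^[1+n]⇒m/10^n<10 n m m<10^[1+n] =
  *-cancelʳ-< (10 ^ n) _ 10 (≤-<-trans ([m/10^n]*10^n≤m n m) m<10^[1+n])

/10^-sandwich : ∀ n m a → m /10^ n ≡ a → a * 10 ^ n ≤ m × m < suc a * 10 ^ n
/10^-sandwich n m _ refl = [m/10^n]*10^n≤m n m , m<[1+m/10^n]*10^n n m

∣m-n∣<o : ∀ {m n o} → m < o → n < o → ∣ m - n ∣ < o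
∣m-n∣<o {m} {n} m<o n<o with ≤-total m n
... | inj₁ m≤n rewrite m≤n⇒m∸n≡0 m≤n = ≤-<-trans (m∸n≤m n m) n<o
... | inj₂ n≤m rewrite m≤n⇒m∸n≡0 n≤m | +-identityʳ (m ∸ n) = ≤-<-trans (m∸n≤m m n) m<o

HasDigits⇒≤ : ∀ n n' {x} → HasDigits n x → HasDigits n' x → n ≤ n'
HasDigits⇒≤ _ _ (10^[n-1]≤x , _) (_ , x<10^n') = ≮⇒≥ λ where
  (s≤s n'≤n-1) → <⇒≱ x<10^n' (≤-trans (^-monoʳ-≤ 10 n'≤n-1) 10^[n-1]≤x)

HasDigits-unique : ∀ n n' {x} → HasDigits n x → HasDigits n' x → n ≡ n'
HasDigits-unique n n' dx dx' = ≤-antisym (HasDigits⇒≤ n n' dx dx') (HasDigits⇒≤ n' n dx' dx)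

fromDigits-++ : ∀ xs ys →
  fromDigits (xs ++ ys) ≡ fromDigits xs + 10 ^ length xs * fromDigits ys
fromDigits-++ []       ys = sym (+-identityʳ (fromDigits ys))
fromDigits-++ (d ∷ xs) ys = begin
  d + 10 * fromDigits (xs ++ ys)
    ≡⟨ cong (λ t → d + 10 * t) (fromDigits-++ xs ys) ⟩
  d + 10 * (fromDigits xs + 10 ^ length xs * fromDigits ys)
    ≡⟨ distrib d (fromDigits xs) (10 ^ length xs) (fromDigits ys) ⟩
  d + 10 * fromDigits xs + 10 * 10 ^ length xs * fromDigits ys
    ∎
  where
  open ≡-Reasoning
  distrib : ∀ d u p v → d + 10 * (u + p * v) ≡ d + 10 * u + 10 * p * v
  distrib = solve-∀

length-digitsN : ∀ n x → length (digitsN n x) ≡ n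
length-digitsN zero    x = refl
length-digitsN (suc n) x = cong suc (length-digitsN n (x / 10))

digitsN-suc : ∀ n x → digitsN (suc n) x ≡ digitsN n x ++ [ x /10^ n % 10 ]
digitsN-suc zero    x = refl
digitsN-suc (suc n) x = cong (x % 10 ∷_) (digitsN-suc n (x / 10))

revN-suc-msd : ∀ n x → revN (suc n) x ≡ x /10^ n % 10 + 10 * revN n x
revN-suc-msd n x = begin
  fromDigits (reverse (digitsN (suc n) x))
    ≡⟨ cong (fromDigits ∘′ reverse) (digitsN-suc n x) ⟩
  fromDigits (reverse (digitsN n x ++ [ x /10^ n % 10 ]))
    ≡⟨ cong fromDigits (reverse-++ (digitsN n x) [ x /10^ n % 10 ]) ⟩
  x /10^ n % 10 + 10 * revN n x ∎
  where open ≡-Reasoning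

revN-suc-lsd : ∀ n x → revN (suc n) x ≡ revN n (x / 10) + 10 ^ n * (x % 10)
revN-suc-lsd n x = begin
  fromDigits (reverse (x % 10 ∷ ds))
    ≡⟨ cong fromDigits (unfold-reverse (x % 10) ds) ⟩
  fromDigits (reverse ds ++ [ x % 10 ])
    ≡⟨ fromDigits-++ (reverse ds) [ x % 10 ] ⟩
  fromDigits (reverse ds) + 10 ^ length (reverse ds) * (x % 10 + 0)
    ≡⟨ cong₂ (λ l d → revN n (x / 10) + 10 ^ l * d)
         (trans (length-reverse ds) (length-digitsN n (x / 10))) (+-identityʳ (x % 10)) ⟩
  revN n (x / 10) + 10 ^ n * (x % 10) ∎
  where
  open ≡-Reasoning
  ds = digitsN n (x / 10)

revN<10^n : ∀ n x → revN n x < 10 ^ n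
revN<10^n zero    x = s≤s z≤n
revN<10^n (suc n) x = begin-strict
  revN (suc n) x                       ≡⟨ revN-suc-lsd n x ⟩
  revN n (x / 10) + 10 ^ n * (x % 10)  <⟨ +-monoˡ-< _ (revN<10^n n (x / 10)) ⟩
  10 ^ n + 10 ^ n * (x % 10)           ≡⟨ cong (10 ^ n +_) (*-comm (10 ^ n) (x % 10)) ⟩
  suc (x % 10) * 10 ^ n                ≤⟨ *-monoˡ-≤ (10 ^ n) (m%n<n x 10) ⟩
  10 * 10 ^ n                          ∎
  where open ≤-Reasoning

revN-suc%10 : ∀ n x → x /10^ n < 10 → revN (suc n) x % 10 ≡ x /10^ n
revN-suc%10 n x a<10 = begin
  revN (suc n) x % 10            ≡⟨ cong (_% 10) (revN-suc-msd n x) ⟩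
  (a % 10 + 10 * revN n x) % 10  ≡⟨ cong (λ t → (a % 10 + t) % 10) (*-comm 10 (revN n x)) ⟩
  (a % 10 + revN n x * 10) % 10  ≡⟨ [m+kn]%n≡m%n (a % 10) (revN n x) 10 ⟩
  a % 10 % 10                    ≡⟨ m%n%n≡m%n a 10 ⟩
  a % 10                         ≡⟨ m<n⇒m%n≡m a<10 ⟩
  a                              ∎
  where
  open ≡-Reasoning
  a = x /10^ n

DigitConstraint : ℕ → ℕ → Set
DigitConstraint k e = let a = k * e % 10 in
  2 ≤ k → 0 < a → k * a < suc e → e < k * suc a → k ≡ 9 ⊎ (a ≡ 2 × e ≡ 8)

digitConstraint? : ∀ k e → Dec (DigitConstraint k e)
digitConstraint? k e = let a = k * e % 10 in
  2 ≤? k →-dec 0 <? a →-dec k * a <? suc e →-dec e <? k * suc a →-dec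
  (k ≟ 9 ⊎-dec (a ≟ 2 ×-dec e ≟ 8))

digitConstraint : ∀ {k e} → k < 10 → e < 10 → DigitConstraint k e
digitConstraint k<10 = from-yes (allUpTo? (λ k → allUpTo? (digitConstraint? k) 10) 10) k<10

reverseMultiple-digitBounds : ∀ m B k .{{_ : NonZero k}} → revN (suc m) B ≡ k * B →
  k * (B /10^ m) < suc (B % 10) × B % 10 < k * suc (B /10^ m)
reverseMultiple-digitBounds m B k rev≡kB = *-cancelʳ-< P _ _ upper , *-cancelʳ-< P _ _ lower
  where
  open ≤-Reasoning
  P = 10 ^ m
  a = B /10^ m
  e = B % 10
  v = revN m (B / 10)
  kB≡v+Pe : k * B ≡ v + P * e
  kB≡v+Pe = trans (sym rev≡kB) (revN-suc-lsd m B)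
  upper : k * a * P < suc e * P
  upper = begin-strict
    k * a * P    ≡⟨ *-assoc k a P ⟩
    k * (a * P)  ≤⟨ *-monoʳ-≤ k ([m/10^n]*10^n≤m m B) ⟩
    k * B        ≡⟨ kB≡v+Pe ⟩
    v + P * e    <⟨ +-monoˡ-< (P * e) (revN<10^n m (B / 10)) ⟩
    P + P * e    ≡⟨ cong (P +_) (*-comm P e) ⟩
    suc e * P    ∎
  lower : e * P < k * suc a * P
  lower = begin-strict
    e * P            ≡⟨ *-comm e P ⟩
    P * e            ≤⟨ m≤n+m (P * e) v ⟩
    v + P * e        ≡⟨ kB≡v+Pe ⟨
    k * B            <⟨ *-monoʳ-< k (m<[1+m/10^n]*10^n m B) ⟩
    k * (suc a * P)  ≡⟨ *-assoc k (suc a) P ⟨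
    k * suc a * P    ∎

reverseMultiple-leadingDigit : ∀ m B k → B < 10 ^ suc m → k < 10 →
  revN (suc m) B ≡ k * B → B /10^ m ≡ k * (B % 10) % 10
reverseMultiple-leadingDigit m B k B<10^[1+m] k<10 rev≡kB = begin
  B /10^ m                ≡⟨ revN-suc%10 m B (m<10^[1+n]⇒m/10^n<10 m B B<10^[1+m]) ⟨
  revN (suc m) B % 10     ≡⟨ cong (_% 10) rev≡kB ⟩
  k * B % 10              ≡⟨ %-distribˡ-* k B 10 ⟩
  k % 10 * (B % 10) % 10  ≡⟨ cong (λ t → t * (B % 10) % 10) (m<n⇒m%n≡m k<10) ⟩
  k * (B % 10) % 10       ∎
  where open ≡-Reasoning

reverseMultiple-cases : ∀ m B k → HasDigits (suc m) B → 2 ≤ k → k < 10 →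
  revN (suc m) B ≡ k * B → k ≡ 9 ⊎ (B /10^ m ≡ 2 × B % 10 ≡ 8)
reverseMultiple-cases m B k (10^m≤B , B<10^[1+m]) 2≤k@(s≤s (s≤s _)) k<10 rev≡kB =
  map₂ (map₁ (trans a≡ke%10))
    (digitConstraint k<10 (m%n<n B 10) 2≤k
      (subst (0 <_) a≡ke%10 (10^n≤m⇒0<m/10^n m B 10^m≤B))
      (subst (λ a → k * a < suc (B % 10)) a≡ke%10 (proj₁ digitBounds))
      (subst (λ a → B % 10 < k * suc a) a≡ke%10 (proj₂ digitBounds)))
  where
  a≡ke%10 = reverseMultiple-leadingDigit m B k B<10^[1+m] k<10 rev≡kB
  digitBounds = reverseMultiple-digitBounds m B k rev≡kB

ballSum%10 : ∀ M y → y < 10 ^ suc M →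
  (y + revN (suc M) y) % 10 ≡ (y % 10 + y /10^ M) % 10
ballSum%10 M y y<10^[1+M] = begin
  (y + revN (suc M) y) % 10            ≡⟨ %-distribˡ-+ y (revN (suc M) y) 10 ⟩
  (y % 10 + revN (suc M) y % 10) % 10  ≡⟨ cong (λ t → (y % 10 + t) % 10) rev%10≡c ⟩
  (y % 10 + y /10^ M) % 10             ∎
  where
  open ≡-Reasoning
  rev%10≡c = revN-suc%10 M y (m<10^[1+n]⇒m/10^n<10 M y y<10^[1+M])

ballSum-lowerBound : ∀ M y → (y % 10 + y /10^ M) * 10 ^ M ≤ y + revN (suc M) y
ballSum-lowerBound M y = begin
  (d + c) * P         ≡⟨ *-distribʳ-+ P d c ⟩
  d * P + c * P       ≡⟨ +-comm (d * P) (c * P) ⟩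
  c * P + d * P       ≤⟨ +-mono-≤ ([m/10^n]*10^n≤m M y) dP≤revN ⟩
  y + revN (suc M) y  ∎
  where
  open ≤-Reasoning
  P = 10 ^ M
  c = y /10^ M
  d = y % 10
  dP≤revN : d * P ≤ revN (suc M) y
  dP≤revN = begin
    d * P                      ≡⟨ *-comm d P ⟩
    P * d                      ≤⟨ m≤n+m (P * d) (revN M (y / 10)) ⟩
    revN M (y / 10) + P * d    ≡⟨ revN-suc-lsd M y ⟨
    revN (suc M) y             ∎

ballSum-range : ∀ M y B → y < 10 ^ suc M → B ≡ y + revN (suc M) y → B % 10 ≡ 8 →
  8 * 10 ^ M ≤ B × B < 2 * 10 ^ suc M
ballSum-range M y _ y<10^[1+M] refl B%10≡8 =
  ≤-trans (*-monoˡ-≤ (10 ^ M) 8≤d+c) (ballSum-lowerBound M y) ,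
  (begin-strict
    y + revN (suc M) y  <⟨ +-mono-< y<10^[1+M] (revN<10^n (suc M) y) ⟩
    X + X               ≡⟨ cong (X +_) (+-identityʳ X) ⟨
    2 * X               ∎)
  where
  open ≤-Reasoning
  X = 10 ^ suc M
  8≤d+c : 8 ≤ y % 10 + y /10^ M
  8≤d+c = subst (_≤ y % 10 + y /10^ M) (trans (sym (ballSum%10 M y y<10^[1+M])) B%10≡8)
                (m%n≤m (y % 10 + y /10^ M) 10)

powerIntervals-disjoint : ∀ m M B → 2 * 10 ^ m ≤ B × B < 3 * 10 ^ m →
  8 * 10 ^ M ≤ B × B < 2 * 10 ^ suc M → ⊥
powerIntervals-disjoint m M B (2·10^m≤B , B<3·10^m) (8·10^M≤B , B<2·10^[1+M])
  with ≤-<-connex m M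
... | inj₁ m≤M = <⇒≱ (begin-strict
      B           <⟨ B<3·10^m ⟩
      3 * 10 ^ m  ≤⟨ *-monoʳ-≤ 3 (^-monoʳ-≤ 10 m≤M) ⟩
      3 * 10 ^ M  ≤⟨ *-monoˡ-≤ (10 ^ M) (m≤m+n 3 5) ⟩
      8 * 10 ^ M  ∎) 8·10^M≤B
  where open ≤-Reasoning
... | inj₂ M<m = <⇒≱ (begin-strict
      B               <⟨ B<2·10^[1+M] ⟩
      2 * 10 ^ suc M  ≤⟨ *-monoʳ-≤ 2 (^-monoʳ-≤ 10 M<m) ⟩
      2 * 10 ^ m      ∎) 2·10^m≤B
  where open ≤-Reasoning

ballMagic-¬leading2-units8 : ∀ m B → BallMagic B → B /10^ m ≡ 2 → B % 10 ≡ 8 → ⊥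
ballMagic-¬leading2-units8 m B (suc M , x , _ , (_ , x<10^[1+M]) , _ , B≡y+y') a≡2 e≡8 =
  powerIntervals-disjoint m M B (/10^-sandwich m B 2 a≡2)
    (ballSum-range M _ B (∣m-n∣<o x<10^[1+M] (revN<10^n (suc M) x)) B≡y+y' e≡8)

Reverse-unique : ∀ n {B B'} → HasDigits n B → Reverse B B' → B' ≡ revN n B
Reverse-unique n digits (n' , digits' , B'≡revB)
  with refl ← HasDigits-unique n n' digits digits' = B'≡revB

corollary5 : (B : ℕ) → 0 < B → BallMagic B → ReverseDivisor B →
    (B' : ℕ) → Reverse B B' → B + B' ≡ 10 * B
corollary5 B _ ballMagic (suc m , k , _ , digits , _ , 2≤k , k<10 , rev≡kB) B' reverse
  with reverseMultiple-cases m B k digits 2≤k k<10 rev≡kB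
... | inj₁ refl = cong (B +_) (trans (Reverse-unique (suc m) digits reverse) rev≡kB)
... | inj₂ (a≡2 , e≡8) = ⊥-elim (ballMagic-¬leading2-units8 m B ballMagic a≡2 e≡8)
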